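{- Let $G=(V,E)$ be a finite simple undirected graph with $V=\{0,\dots,n-1\}$, and let the nodes be distributed over processing elements (PEs) $0,\dots,P-1$ in contiguous ranges: PE $p$ owns the nodes $a_p,\dots,b_p$, where $a_0=0$, $a_{p+1}=b_p+1$, $b_{P-1}=n-1$. For each node $u$ with degree $d(u)$, let $v_1<v_2<\dots<v_{d(u)}$ be its neighbors listed in increasing global ID. On PE $p$, the directed edges $(u,v_i)$ for owned nodes $u$ are numbered consecutively: owned nodes in increasing order, and for each $u$ its edges $(u,v_1),\dots,(u,v_{d(u)})$ receive local IDs $e_u, e_u+1,\dots,e_u+d(u)-1$; let $m_p$ be the number of such directed edges on PE $p$ and $M_p=\sum_{q<p} m_q$. The $i$-th split node of $u$ (owned by $p$) is $u'_i := M_p+e_u+i-1$, and $S_u=\{u'_1,\dots,u'_{d(u)}\}$. Run the following distributed construction (dSPAC): (1) For every node $u$ owned by PE $p$ and every PE $q$ that owns at least one neighbor of $u$, let $\mathcal{E}_q(u)$ be the global ID $M_p+e_u+j-1$, where $v_j$ is the first neighbor of $u$ (in the order above) owned by $q$; this value is made available on PE $q$ (sent to $q$ if $q\neq p$). (2) Each PE $q$ traverses its owned nodes $w$ in increasing ID order, and for each $w$ traverses its neighbors $x_1,\dots,x_{d(w)}$ in increasing ID order; for the $i$-th neighbor $x_i$ it creates the directed dominant edge $(w'_i,\ \mathcal{E}_q(x_i))$ with weight $\infty$ and then increments its stored value $\mathcal{E}_q(x_i)$ by one. (3) For each owned node $u$ with $d(u)>1$, each PE inserts auxiliary edges of weight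 $1$ between $u'_i$ and $u'_{i+1}$ for $i=1,\dots,d(u)-1$ and between $u'_{d(u)}$ and $u'_1$ (a single edge if $d(u)=2$). Then the resulting graph is a valid split graph of $G$: the split node sets $S_u$, $u\in V$, partition the node set, auxiliary edges connect the nodes of each $S_u$ into a cycle (a single edge if $|S_u|=2$), and the directed dominant edges created are symmetric, i.e., for every created directed dominant edge $(x,y)$ the edge $(y,x)$ is also created, so that they form undirected dominant edges with each split node incident to exactly one dominant edge and, for every edge $\{u,v\}\in E$, exactly one dominant edge joining a node of $S_u$ to a node of $S_v$.
   Context: Split-and-connect (SPAC) transformation: given an undirected unweighted graph $G=(V,E)$, its split graph $G'$ has, for each node $v\in V$, a set $S_v$ of $d(v)$ split nodes connected to a cycle by auxiliary edges of weight one, and for each edge $\{u,v\}\in E$ one dominant edge of weight $\infty$ between a split node of $S_u$ and a split node of $S_v$, chosen so that every split node is incident to exactly one dominant edge. A valid split graph is one satisfying these requirements. The construction above is the distributed algorithm whose output is claimed valid. -}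

module Defs where

open import Data.Bool using (Bool; true; false; if_then_else_; _∧_)
open import Data.Nat using (ℕ; zero; suc; _+_; _∸_; _≤_; _<_; _≡ᵇ_; _<ᵇ_)
open import Data.Nat.Properties using () renaming (_≟_ to _≟ℕ_)
open import Data.Fin using (Fin; toℕ)
open import Data.Nat.ListAction using (sum)
open import Data.List using (List; []; _∷_; filter; filterᵇ; map; length; concatMap; allFin; applyUpTo; upTo; _++_)
open import Data.List.Membership.DecPropositional _≟ℕ_ using (_∈?_)
open import Data.Maybe using (Maybe; just; nothing; maybe)
open import Data.Product using (_×_; _,_; proj₁; proj₂)
open import Relation.Nullary.Decidable using (_×-dec_)
open import Relation.Binary.PropositionalEquality using (_≡_)

record SimpleGraph (n : ℕ) : Set where
  field
    adj     : Fin n → Fin n → Bool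
    adj-sym : ∀ u v → adj u v ≡ adj v u
    adj-irr : ∀ u → adj u u ≡ false

-- Nodes distributed over PEs 0,…,P-1 in contiguous ranges:
-- the owner map is monotone (node IDs in increasing order are owned by
-- PEs in non-decreasing order), i.e. PE p owns an interval a_p..b_p.
ContiguousOwner : {n P : ℕ} → (Fin n → Fin P) → Set
ContiguousOwner {n} own = ∀ (u v : Fin n) → toℕ u ≤ toℕ v → toℕ (own u) ≤ toℕ (own v)

enumFrom : {A : Set} → ℕ → List A → List (ℕ × A)
enumFrom k []       = []
enumFrom k (x ∷ xs) = (k , x) ∷ enumFrom (suc k) xs

firstPos : {A : Set} → (A → Bool) → List A → Maybe ℕ
firstPos p []       = nothing
firstPos p (x ∷ xs) = if p x then just 1 else maybe (λ j → just (suc j)) nothing (firstPos p xs)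

pathEdges : List ℕ → List (ℕ × ℕ)
pathEdges []           = []
pathEdges (x ∷ [])     = []
pathEdges (x ∷ y ∷ xs) = (x , y) ∷ pathEdges (y ∷ xs)

lastOf : ℕ → List ℕ → ℕ
lastOf d []       = d
lastOf d (x ∷ xs) = lastOf x xs

cycleEdges : List ℕ → List (ℕ × ℕ)
cycleEdges []               = []
cycleEdges (x ∷ [])         = []
cycleEdges (x ∷ y ∷ [])     = (x , y) ∷ []
cycleEdges (x ∷ y ∷ z ∷ xs) = pathEdges (x ∷ y ∷ z ∷ xs) ++ ((lastOf z xs , x) ∷ [])

module dSPAC {n P : ℕ} (G : SimpleGraph n) (own : Fin n → Fin P) where
  open SimpleGraph G

  _==_ : {k : ℕ} → Fin k → Fin k → Bool
  a == b = toℕ a ≡ᵇ toℕ b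

  _≺_ : {k : ℕ} → Fin k → Fin k → Bool
  a ≺ b = toℕ a <ᵇ toℕ b

  nbrs : Fin n → List (Fin n)
  nbrs u = filterᵇ (adj u) (allFin n)

  deg : Fin n → ℕ
  deg u = length (nbrs u)

  owned : Fin P → List (Fin n)
  owned p = filterᵇ (λ u → own u == p) (allFin n)

  e : Fin n → ℕ
  e u = sum (map deg (filterᵇ (λ w → (own w == own u) ∧ (w ≺ u)) (allFin n)))

  m : Fin P → ℕ
  m p = sum (map deg (owned p))

  M : Fin P → ℕ
  M p = sum (map m (filterᵇ (λ q → q ≺ p) (allFin P)))

  -- total number of split nodes; the node set of the split graph is {0,…,N-1}
  N : ℕ
  N = sum (map m (allFin P))

  split : Fin n → ℕ → ℕ
  split u i = M (own u) + e u + i ∸ 1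

  S : Fin n → List ℕ
  S u = applyUpTo (λ k → split u (suc k)) (deg u)

  -- For nodes u without a neighbour owned
  -- by q the value is never used; it is set to 0.
  initE : Fin P → Fin n → ℕ
  initE q u = maybe (λ j → M (own u) + e u + j ∸ 1) 0 (firstPos (λ v → own v == q) (nbrs u))

  work : Fin P → List (ℕ × Fin n)
  work q = concatMap (λ w → map (λ ix → (split w (proj₁ ix) , proj₂ ix)) (enumFrom 1 (nbrs w))) (owned q)

  increment : (Fin n → ℕ) → Fin n → (Fin n → ℕ)
  increment E x y = if y == x then suc (E x) else E y

  run : (Fin n → ℕ) → List (ℕ × Fin n) → List (ℕ × ℕ)
  run E []             = []
  run E ((s , x) ∷ ws) = (s , E x) ∷ run (increment E x) ws

  dominantEdges : List (ℕ × ℕ)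
  dominantEdges = concatMap (λ q → run (initE q) (work q)) (allFin P)

  auxFor : Fin n → List (ℕ × ℕ)
  auxFor u with deg u
  ... | zero                = []
  ... | suc zero            = []
  ... | suc (suc zero)      = (split u 1 , split u 2) ∷ []
  ... | suc (suc (suc k))   =
        applyUpTo (λ j → (split u (suc j) , split u (suc (suc j)))) (suc (suc k))
        ++ ((split u (suc (suc (suc k))) , split u 1) ∷ [])

  auxiliaryEdges : List (ℕ × ℕ)
  auxiliaryEdges = concatMap auxFor (allFin n)

  outCount : ℕ → ℕ
  outCount x = length (filter (λ ed → proj₁ ed ≟ℕ x) dominantEdges)

  betweenCount : Fin n → Fin n → ℕ
  betweenCount u v = length (filter (λ ed → (proj₁ ed ∈? S u) ×-dec (proj₂ ed ∈? S v)) dominantEdges)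

module Submission where

-- The dominant edges created by dSPAC are exactly the pairs (w′ᵢ , x′ⱼ) for adjacent w and x, where i is
-- the rank of x among the neighbours of w and j the rank of w among the neighbours of x. Indeed, when PE q
-- reaches its node w, the counter 𝓔_q(x) of a neighbour x holds the position of the first neighbour of x
-- owned by q plus the number of neighbours of x owned by q that precede w. Since ownership is contiguous,
-- the neighbours of x owned by q form a segment of the neighbour list of x that contains w, so this sum is
-- the rank of w among the neighbours of x. Everything else follows because the split nodes are numbered
-- block by block and so enumerate {0,…,N-1} exactly once.

open import Defs
open import Data.Bool using (Bool; true; false; if_then_else_; _∧_; T)
open import Data.Bool.Properties using (T-≡; T-∧; ∧-zeroʳ; ∧-assoc; ∧-comm)
open import Data.Empty using (⊥; ⊥-elim)
open import Data.Fin using (Fin; toℕ)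
open import Data.Fin.Properties using (toℕ-injective)
open import Data.List
  using (List; []; _∷_; _++_; concat; filter; filterᵇ; map; length; concatMap; allFin; applyUpTo; upTo)
open import Data.List.Properties
  using ( map-cong-local; map-∘; map-applyUpTo; map-concatMap; concatMap-cong; ++-assoc; ++-identityʳ
        ; filter-accept; filter-reject; filter-none)
open import Data.List.Membership.Propositional using (_∈_)
open import Data.List.Membership.Propositional.Properties
  using (∈-allFin; ∈-filter⁺; ∈-filter⁻; ∈-map⁺; ∈-map⁻; ∈-++⁺ʳ; ∈-concatMap⁺; ∈-concatMap⁻; ∈-upTo⁺; ∈-upTo⁻)
open import Data.List.Relation.Unary.All as All using (All; []; _∷_)
open import Data.List.Relation.Unary.Any as Any using (here; there)
open import Data.List.Relation.Unary.AllPairs using (AllPairs; []; _∷_)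
import Data.List.Relation.Unary.AllPairs.Properties as AllPairs
open import Data.List.Relation.Unary.Unique.Propositional using (Unique)
open import Data.List.Relation.Unary.Unique.Propositional.Properties using (upTo⁺; map⁻)
open import Data.List.Relation.Binary.Permutation.Propositional
  using (_↭_; ↭-refl; ↭-sym; ↭-trans; ↭-reflexive; ↭⇒↭ₛ; module PermutationReasoning)
open import Data.List.Relation.Binary.Permutation.Propositional.Properties
  using (++⁺ˡ; shifts; ∈-resp-↭; ↭-length; filter-↭)
import Data.List.Relation.Binary.Permutation.Setoid.Properties as PermutationSetoid
open import Data.Maybe using (just; nothing; maybe)
open import Data.Nat using (ℕ; zero; suc; _+_; _∸_; _≤_; _<_; _≡ᵇ_; _<ᵇ_)
open import Data.Nat.ListAction using (sum)
open import Data.Nat.Properties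
  using (_≟_; ≡ᵇ⇒≡; ≡⇒≡ᵇ; <ᵇ⇒<; <⇒<ᵇ; <⇒≢; >⇒≢; ≤⇒≯; <⇒≤; ≤-refl; ≤-antisym; +-identityʳ; +-suc; +-assoc)
open import Data.Product using (∃; _×_; _,_; proj₁; proj₂)
open import Function using (_∘_)
open import Function.Bundles using (Equivalence)
open import Relation.Binary.PropositionalEquality
  using (_≡_; _≢_; refl; sym; trans; cong; cong₂; subst; setoid; module ≡-Reasoning)
open import Relation.Nullary using (¬_; yes; no; does)
open import Relation.Nullary.Decidable using (T?; _×-dec_)
open import Data.List.Membership.DecPropositional _≟_ using (_∈?_)
open import Relation.Unary using (Decidable)

private
  variable
    A B : Set
    k : ℕ

filterᵇ-filterᵇ : ∀ (p r : A → Bool) xs → filterᵇ p (filterᵇ r xs) ≡ filterᵇ (λ x → r x ∧ p x) xs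
filterᵇ-filterᵇ p r [] = refl
filterᵇ-filterᵇ p r (x ∷ xs) with r x
... | false = filterᵇ-filterᵇ p r xs
... | true with p x
...   | true  = cong (x ∷_) (filterᵇ-filterᵇ p r xs)
...   | false = filterᵇ-filterᵇ p r xs

filterᵇ-cong-local : ∀ {p r : A → Bool} {xs} → All (λ x → p x ≡ r x) xs → filterᵇ p xs ≡ filterᵇ r xs
filterᵇ-cong-local [] = refl
filterᵇ-cong-local {p = p} {r} {x ∷ xs} (px≡rx ∷ eqs) with p x | r x | px≡rx
... | true  | true  | refl = cong (x ∷_) (filterᵇ-cong-local eqs)
... | false | false | refl = filterᵇ-cong-local eqs

applyUpTo-cong : ∀ {f g : ℕ → A} → (∀ i → f i ≡ g i) → ∀ m → applyUpTo f m ≡ applyUpTo g m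
applyUpTo-cong f≗g zero    = refl
applyUpTo-cong f≗g (suc m) = cong₂ _∷_ (f≗g 0) (applyUpTo-cong (f≗g ∘ suc) m)

applyUpTo-+ : ∀ (f : ℕ → A) a b → applyUpTo f (a + b) ≡ applyUpTo f a ++ applyUpTo (λ i → f (a + i)) b
applyUpTo-+ f zero    b = refl
applyUpTo-+ f (suc a) b = cong (f 0 ∷_) (applyUpTo-+ (f ∘ suc) a b)

map-proj₁-enumFrom : ∀ (s : ℕ) (L : List A) → map proj₁ (enumFrom s L) ≡ applyUpTo (s +_) (length L)
map-proj₁-enumFrom s []      = refl
map-proj₁-enumFrom s (x ∷ L) =
  cong₂ _∷_ (sym (+-identityʳ s))
            (trans (map-proj₁-enumFrom (suc s) L) (applyUpTo-cong (λ i → sym (+-suc s i)) (length L)))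

pathEdges-applyUpTo : ∀ (f : ℕ → ℕ) d → pathEdges (applyUpTo f (suc d)) ≡ applyUpTo (λ j → (f j , f (suc j))) d
pathEdges-applyUpTo f zero    = refl
pathEdges-applyUpTo f (suc d) = cong ((f 0 , f 1) ∷_) (pathEdges-applyUpTo (f ∘ suc) d)

lastOf-applyUpTo : ∀ (f : ℕ → ℕ) d → lastOf (f 0) (applyUpTo (f ∘ suc) d) ≡ f d
lastOf-applyUpTo f zero    = refl
lastOf-applyUpTo f (suc d) = lastOf-applyUpTo (f ∘ suc) d

firstPos-here : ∀ (p : A → Bool) {x xs} → T (p x) → firstPos p (x ∷ xs) ≡ just 1
firstPos-here p {x} px with p x
... | true = refl

firstPos-there : ∀ (p : A → Bool) {x xs j} → ¬ T (p x) → firstPos p xs ≡ just j →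
                 firstPos p (x ∷ xs) ≡ just (suc j)
firstPos-there p {x} ¬px first with p x
... | false = cong (maybe (λ j → just (suc j)) nothing) first
... | true  = ⊥-elim (¬px _)

concatMap-++-↭ : ∀ (C D : A → List B) xs → concatMap (λ q → C q ++ D q) xs ↭ concatMap C xs ++ concatMap D xs
concatMap-++-↭ C D []       = ↭-refl
concatMap-++-↭ C D (q ∷ qs) = begin
  (C q ++ D q) ++ concatMap (λ q → C q ++ D q) qs  ≡⟨ ++-assoc (C q) (D q) _ ⟩
  C q ++ D q ++ concatMap (λ q → C q ++ D q) qs    ↭⟨ ++⁺ˡ (C q) (++⁺ˡ (D q) (concatMap-++-↭ C D qs)) ⟩
  C q ++ D q ++ concatMap C qs ++ concatMap D qs   ↭⟨ ++⁺ˡ (C q) (shifts (D q) (concatMap C qs)) ⟩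
  C q ++ concatMap C qs ++ D q ++ concatMap D qs   ≡⟨ ++-assoc (C q) _ _ ⟨
  (C q ++ concatMap C qs) ++ D q ++ concatMap D qs ∎
  where open PermutationReasoning

concatMap-if : ∀ (p : A → Bool) (Z : List B) xs →
               concatMap (λ q → if p q then Z else []) xs ≡ concatMap (λ _ → Z) (filterᵇ p xs)
concatMap-if p Z [] = refl
concatMap-if p Z (x ∷ xs) with p x
... | true  = cong (Z ++_) (concatMap-if p Z xs)
... | false = concatMap-if p Z xs

Unique-resp-↭ : ∀ {xs ys : List A} → xs ↭ ys → Unique xs → Unique ys
Unique-resp-↭ = PermutationSetoid.Unique-resp-↭ (setoid _) ∘ ↭⇒↭ₛ

Unique-++-disjoint : ∀ {xs ys : List A} {a} → Unique (xs ++ ys) → a ∈ xs → a ∈ ys → ⊥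
Unique-++-disjoint {xs = x ∷ xs} (x∉ ∷ _) (here refl) a∈ys = All.lookup x∉ (∈-++⁺ʳ xs a∈ys) refl
Unique-++-disjoint {xs = x ∷ xs} (_ ∷ u)  (there a∈xs) a∈ys = Unique-++-disjoint u a∈xs a∈ys

Unique-++⁻ʳ : ∀ (xs : List A) {ys} → Unique (xs ++ ys) → Unique ys
Unique-++⁻ʳ []       u       = u
Unique-++⁻ʳ (x ∷ xs) (_ ∷ u) = Unique-++⁻ʳ xs u

Unique-concatMap⇒disjoint : ∀ {f : A → List B} {xs w u a} → Unique (concatMap f xs) →
                            w ∈ xs → u ∈ xs → a ∈ f w → a ∈ f u → w ≡ u
Unique-concatMap⇒disjoint {xs = x ∷ xs} U (here refl) (here refl) _ _ = refl
Unique-concatMap⇒disjoint {f = f} {xs = x ∷ xs} U (here refl) (there u∈) a∈fw a∈fu =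
  ⊥-elim (Unique-++-disjoint U a∈fw (∈-concatMap⁺ f (Any.map (λ { refl → a∈fu }) u∈)))
Unique-concatMap⇒disjoint {f = f} {xs = x ∷ xs} U (there w∈) (here refl) a∈fw a∈fu =
  ⊥-elim (Unique-++-disjoint U a∈fu (∈-concatMap⁺ f (Any.map (λ { refl → a∈fw }) w∈)))
Unique-concatMap⇒disjoint {f = f} {xs = x ∷ xs} U (there w∈) (there u∈) a∈fw a∈fu =
  Unique-concatMap⇒disjoint (Unique-++⁻ʳ (f x) U) w∈ u∈ a∈fw a∈fu

length-filter-unique : ∀ {P : A → Set} (P? : Decidable P) {L : List A} {x} → Unique L → x ∈ L → P x →
                       (∀ y → y ∈ L → P y → y ≡ x) → length (filter P? L) ≡ 1
length-filter-unique P? {y ∷ ys} (y∉ys ∷ u) x∈L px onlyX with P? y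
... | yes py = cong (suc ∘ length) (filter-none P? (All.tabulate λ {z} z∈ys pz →
                 All.lookup y∉ys z∈ys (trans (onlyX y (here refl) py) (sym (onlyX z (there z∈ys) pz)))))
... | no ¬py with x∈L
...   | here refl   = ⊥-elim (¬py px)
...   | there x∈ys = length-filter-unique P? u x∈ys px (λ z z∈ys → onlyX z (there z∈ys))

length-filter-map : ∀ {P : B → Set} (P? : Decidable P) (g : A → B) L →
                    length (filter (P? ∘ g) L) ≡ length (filter P? (map g L))
length-filter-map P? g []      = refl
length-filter-map P? g (x ∷ L) with does (P? (g x))
... | true  = cong suc (length-filter-map P? g L)
... | false = length-filter-map P? g L

-- The comparisons of dSPAC, restated so that lemmas outside that module can mention them.
_==_ : Fin k → Fin k → Bool
a == b = toℕ a ≡ᵇ toℕ b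

_≺_ : Fin k → Fin k → Bool
a ≺ b = toℕ a <ᵇ toℕ b

==⇒≡ : {a b : Fin k} → T (a == b) → a ≡ b
==⇒≡ {a = a} {b} = toℕ-injective ∘ ≡ᵇ⇒≡ (toℕ a) (toℕ b)

==-refl : (a : Fin k) → T (a == a)
==-refl a = ≡⇒≡ᵇ (toℕ a) (toℕ a) refl

≢⇒¬== : {a b : Fin k} → toℕ a ≢ toℕ b → ¬ T (a == b)
≢⇒¬== {a = a} {b} a≢b = a≢b ∘ ≡ᵇ⇒≡ (toℕ a) (toℕ b)

<⇒≺ : {a b : Fin k} → toℕ a < toℕ b → T (a ≺ b)
<⇒≺ = <⇒<ᵇ

≺⇒< : {a b : Fin k} → T (a ≺ b) → toℕ a < toℕ b
≺⇒< {a = a} {b} = <ᵇ⇒< (toℕ a) (toℕ b)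

≤⇒⊀ : {a b : Fin k} → toℕ b ≤ toℕ a → ¬ T (a ≺ b)
≤⇒⊀ b≤a = ≤⇒≯ b≤a ∘ ≺⇒<

Sorted : List (Fin k) → Set
Sorted = AllPairs (λ a b → toℕ a < toℕ b)

allFin-sorted : ∀ k → Sorted (allFin k)
allFin-sorted k = AllPairs.tabulate⁺-< (λ i<j → i<j)

filterᵇ-sorted : ∀ (p : Fin k → Bool) {xs} → Sorted xs → Sorted (filterᵇ p xs)
filterᵇ-sorted p = AllPairs.filter⁺ (T? ∘ p)

before : Fin k → List (Fin k) → List (Fin k)
before x = filterᵇ (_≺ x)

before-head : ∀ {y : Fin k} {ys} → All (λ c → toℕ y < toℕ c) ys → before y (y ∷ ys) ≡ []
before-head {y = y} y<ys =
  filter-none (T? ∘ (_≺ y)) (≤⇒⊀ {a = y} ≤-refl ∷ All.map (λ {c} y<c → ≤⇒⊀ {a = c} (<⇒≤ y<c)) y<ys)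

before-cons : ∀ {x y : Fin k} {ys} → toℕ y < toℕ x → before x (y ∷ ys) ≡ y ∷ before x ys
before-cons {x = x} y<x = filter-accept (T? ∘ (_≺ x)) (<⇒≺ y<x)

filter-==-sorted : ∀ {L : List (Fin k)} {v} → Sorted L → v ∈ L → filterᵇ (v ==_) L ≡ v ∷ []
filter-==-sorted {v = v} (v<L ∷ _) (here refl) =
  trans (filter-accept (T? ∘ (v ==_)) (==-refl v))
        (cong (v ∷_) (filter-none (T? ∘ (v ==_)) (All.map (≢⇒¬== ∘ <⇒≢) v<L)))
filter-==-sorted {v = v} (y<L ∷ sorted) (there v∈L) =
  trans (filter-reject (T? ∘ (v ==_)) (≢⇒¬== (>⇒≢ (All.lookup y<L v∈L)))) (filter-==-sorted sorted v∈L)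

enumFrom-position : (L : List (Fin k)) (s : ℕ) → Sorted L →
                    enumFrom s L ≡ map (λ x → (s + length (before x L) , x)) L
enumFrom-position [] s _ = refl
enumFrom-position (y ∷ ys) s (y<ys ∷ sorted) = cong₂ _∷_ head (trans (enumFrom-position ys (suc s) sorted) tail)
  where
  head : (s , y) ≡ (s + length (before y (y ∷ ys)) , y)
  head = cong (_, y) (sym (trans (cong (λ l → s + length l) (before-head y<ys)) (+-identityʳ s)))
  tail : map (λ x → (suc s + length (before x ys) , x)) ys ≡ map (λ x → (s + length (before x (y ∷ ys)) , x)) ys
  tail = map-cong-local (All.map (λ {x} y<x →
           cong (_, x) (trans (sym (+-suc s _)) (cong (λ l → s + length l) (sym (before-cons y<x))))) y<ys)

concatMap-consecutive : (d : Fin k → ℕ) (Xs : List (Fin k)) → Sorted Xs → ∀ B →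
  concatMap (λ x → applyUpTo (λ i → B + sum (map d (before x Xs)) + i) (d x)) Xs
    ≡ applyUpTo (B +_) (sum (map d Xs))
concatMap-consecutive d [] _ B = refl
concatMap-consecutive d (y ∷ ys) (y<ys ∷ sorted) B = begin
  applyUpTo (λ i → B + sum (map d (before y (y ∷ ys))) + i) (d y)
    ++ concatMap (λ x → applyUpTo (λ i → B + sum (map d (before x (y ∷ ys))) + i) (d x)) ys
    ≡⟨ cong₂ _++_ (applyUpTo-cong firstBlock (d y))
                  (cong concat (map-cong-local (All.map (λ y<x → applyUpTo-cong (laterBlock y<x) _) y<ys))) ⟩
  applyUpTo (B +_) (d y) ++ concatMap (λ x → applyUpTo (λ i → B + d y + sum (map d (before x ys)) + i) (d x)) ys
    ≡⟨ cong (applyUpTo (B +_) (d y) ++_) (concatMap-consecutive d ys sorted (B + d y)) ⟩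
  applyUpTo (B +_) (d y) ++ applyUpTo (B + d y +_) (sum (map d ys))
    ≡⟨ cong (applyUpTo (B +_) (d y) ++_) (applyUpTo-cong (+-assoc B (d y)) _) ⟩
  applyUpTo (B +_) (d y) ++ applyUpTo (λ i → B + (d y + i)) (sum (map d ys))
    ≡⟨ applyUpTo-+ (B +_) (d y) _ ⟨
  applyUpTo (B +_) (d y + sum (map d ys)) ∎
  where
  open ≡-Reasoning
  firstBlock : ∀ i → B + sum (map d (before y (y ∷ ys))) + i ≡ B + i
  firstBlock i = trans (cong (λ l → B + sum (map d l) + i) (before-head y<ys)) (cong (_+ i) (+-identityʳ B))
  laterBlock : ∀ {x} → toℕ y < toℕ x → ∀ i →
               B + sum (map d (before x (y ∷ ys))) + i ≡ B + d y + sum (map d (before x ys)) + i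
  laterBlock y<x i = trans (cong (λ l → B + sum (map d l) + i) (before-cons y<x))
                           (cong (_+ i) (sym (+-assoc B (d y) _)))

concatMap-indicator : ∀ (v : Fin k) (Z : List B) → concatMap (λ q → if v == q then Z else []) (allFin k) ≡ Z
concatMap-indicator {k} v Z = begin
  concatMap (λ q → if v == q then Z else []) (allFin k)
    ≡⟨ concatMap-if (v ==_) Z (allFin k) ⟩
  concatMap (λ _ → Z) (filterᵇ (v ==_) (allFin k))
    ≡⟨ cong (concatMap (λ _ → Z)) (filter-==-sorted (allFin-sorted k) (∈-allFin v)) ⟩
  Z ++ []
    ≡⟨ ++-identityʳ Z ⟩
  Z ∎
  where open ≡-Reasoning

concatMap-groupBy-↭ : ∀ {A B : Set} (g : A → Fin k) (f : A → List B) xs →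
  concatMap (λ q → concatMap f (filterᵇ (λ a → g a == q) xs)) (allFin k) ↭ concatMap f xs
concatMap-groupBy-↭ {k = k} {B = B} g f [] = ↭-reflexive (noBlocks (allFin k))
  where
  noBlocks : ∀ (qs : List (Fin k)) → concatMap {B = B} (λ _ → []) qs ≡ []
  noBlocks []       = refl
  noBlocks (_ ∷ qs) = noBlocks qs
concatMap-groupBy-↭ {k = k} {A} {B} g f (x ∷ xs) = begin
  concatMap (λ q → group q (x ∷ xs)) (allFin k)
    ≡⟨ concatMap-cong split-head (allFin k) ⟩
  concatMap (λ q → (if g x == q then f x else []) ++ group q xs) (allFin k)
    ↭⟨ concatMap-++-↭ (λ q → if g x == q then f x else []) (λ q → group q xs) (allFin k) ⟩
  concatMap (λ q → if g x == q then f x else []) (allFin k) ++ concatMap (λ q → group q xs) (allFin k)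
    ≡⟨ cong (_++ concatMap (λ q → group q xs) (allFin k)) (concatMap-indicator (g x) (f x)) ⟩
  f x ++ concatMap (λ q → group q xs) (allFin k)
    ↭⟨ ++⁺ˡ (f x) (concatMap-groupBy-↭ g f xs) ⟩
  f x ++ concatMap f xs ∎
  where
  open PermutationReasoning
  group : Fin k → List A → List B
  group q ys = concatMap f (filterᵇ (λ a → g a == q) ys)
  split-head : ∀ q → group q (x ∷ xs) ≡ (if g x == q then f x else []) ++ group q xs
  split-head q with g x == q
  ... | true  = refl
  ... | false = refl

module SplitGraphProperties {n P : ℕ} (G : SimpleGraph n) (own : Fin n → Fin P) where
  open SimpleGraph G
  open dSPAC G own hiding (_==_; _≺_)

  nbrs-sorted : ∀ w → Sorted (nbrs w)
  nbrs-sorted w = filterᵇ-sorted (adj w) (allFin-sorted n)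

  owned-sorted : ∀ q → Sorted (owned q)
  owned-sorted q = filterᵇ-sorted (λ u → own u == q) (allFin-sorted n)

  ∈-nbrs⁺ : ∀ {w x} → T (adj w x) → x ∈ nbrs w
  ∈-nbrs⁺ {w} {x} = ∈-filter⁺ (T? ∘ adj w) (∈-allFin x)

  ∈-nbrs⁻ : ∀ {w x} → x ∈ nbrs w → T (adj w x)
  ∈-nbrs⁻ {w} = proj₂ ∘ ∈-filter⁻ (T? ∘ adj w) {xs = allFin n}

  nbrs-sym : ∀ {w x} → x ∈ nbrs w → w ∈ nbrs x
  nbrs-sym {w} {x} x∈ = ∈-nbrs⁺ (subst T (adj-sym w x) (∈-nbrs⁻ x∈))

  ∈-owned⁻ : ∀ {q w} → w ∈ owned q → own w ≡ q
  ∈-owned⁻ {q} = ==⇒≡ ∘ proj₂ ∘ ∈-filter⁻ (T? ∘ (λ u → own u == q)) {xs = allFin n}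

  -- Split nodes

  split-suc : ∀ u i → split u (suc i) ≡ M (own u) + e u + i
  split-suc u i = cong (_∸ 1) (+-suc (M (own u) + e u) i)

  e≡sum-before : ∀ w → e w ≡ sum (map deg (before w (owned (own w))))
  e≡sum-before w = cong (sum ∘ map deg) (sym (filterᵇ-filterᵇ (_≺ w) (λ u → own u == own w) (allFin n)))

  concatMap-S-owned : ∀ q → concatMap S (owned q) ≡ applyUpTo (M q +_) (m q)
  concatMap-S-owned q =
    trans (cong concat (map-cong-local (All.tabulate λ {w} w∈ → applyUpTo-cong (offset w (∈-owned⁻ w∈)) (deg w))))
          (concatMap-consecutive deg (owned q) (owned-sorted q) (M q))
    where
    offset : ∀ w → own w ≡ q → ∀ i → split w (suc i) ≡ M q + sum (map deg (before w (owned q))) + i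
    offset w refl i = trans (split-suc w i) (cong (λ s → M (own w) + s + i) (e≡sum-before w))

  S-partition : concatMap S (allFin n) ↭ upTo N
  S-partition = ↭-trans (↭-sym (concatMap-groupBy-↭ own S (allFin n)))
                        (↭-reflexive (trans (concatMap-cong concatMap-S-owned (allFin P))
                                            (concatMap-consecutive m (allFin P) (allFin-sorted P) 0)))

  S-unique : Unique (concatMap S (allFin n))
  S-unique = Unique-resp-↭ (↭-sym S-partition) (upTo⁺ N)

  auxFor≡cycleEdges : ∀ u → auxFor u ≡ cycleEdges (S u)
  auxFor≡cycleEdges u with deg u
  ... | zero              = refl
  ... | suc zero          = refl
  ... | suc (suc zero)    = refl
  ... | suc (suc (suc k)) =
    cong₂ _++_ (sym (pathEdges-applyUpTo (λ j → split u (suc j)) (suc (suc k))))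
               (cong (λ z → (z , split u 1) ∷ []) (sym (lastOf-applyUpTo (λ j → split u (suc (suc (suc j)))) k)))

  -- Dominant edges of the split graph

  rank : Fin n → Fin n → ℕ
  rank w x = suc (length (before x (nbrs w)))

  splitEdge : Fin n → Fin n → ℕ × ℕ
  splitEdge w x = (split w (rank w x) , split x (rank x w))

  splitEdgesAt : Fin n → List (ℕ × ℕ)
  splitEdgesAt w = map (splitEdge w) (nbrs w)

  splitEdges : List (ℕ × ℕ)
  splitEdges = concatMap splitEdgesAt (allFin n)

  map-rank-nbrs : ∀ w → map (rank w) (nbrs w) ≡ applyUpTo suc (deg w)
  map-rank-nbrs w = begin
    map (rank w) (nbrs w)                             ≡⟨ map-∘ (nbrs w) ⟩
    map proj₁ (map (λ x → (rank w x , x)) (nbrs w))   ≡⟨ cong (map proj₁) (enumFrom-position (nbrs w) 1 (nbrs-sorted w)) ⟨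
    map proj₁ (enumFrom 1 (nbrs w))                   ≡⟨ map-proj₁-enumFrom 1 (nbrs w) ⟩
    applyUpTo suc (deg w)                             ∎
    where open ≡-Reasoning

  map-proj₁-splitEdgesAt : ∀ w → map proj₁ (splitEdgesAt w) ≡ S w
  map-proj₁-splitEdgesAt w = begin
    map proj₁ (map (splitEdge w) (nbrs w))   ≡⟨ map-∘ (nbrs w) ⟨
    map (split w ∘ rank w) (nbrs w)          ≡⟨ map-∘ (nbrs w) ⟩
    map (split w) (map (rank w) (nbrs w))    ≡⟨ cong (map (split w)) (map-rank-nbrs w) ⟩
    map (split w) (applyUpTo suc (deg w))    ≡⟨ map-applyUpTo suc (split w) (deg w) ⟩
    S w                                      ∎
    where open ≡-Reasoning

  sources-splitEdges : map proj₁ splitEdges ≡ concatMap S (allFin n)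
  sources-splitEdges = trans (map-concatMap proj₁ splitEdgesAt (allFin n)) (concatMap-cong map-proj₁-splitEdgesAt (allFin n))

  splitEdges-unique : Unique splitEdges
  splitEdges-unique = map⁻ (subst Unique (sym sources-splitEdges) S-unique)

  split-rank∈S : ∀ {w x} → x ∈ nbrs w → split w (rank w x) ∈ S w
  split-rank∈S {w} {x} x∈ = subst (split w (rank w x) ∈_) (map-proj₁-splitEdgesAt w) (∈-map⁺ proj₁ (∈-map⁺ (splitEdge w) x∈))

  ∈-splitEdges⁺ : ∀ {w x} → x ∈ nbrs w → splitEdge w x ∈ splitEdges
  ∈-splitEdges⁺ {w} x∈ = ∈-concatMap⁺ splitEdgesAt (Any.map (λ { refl → ∈-map⁺ (splitEdge w) x∈ }) (∈-allFin w))

  ∈-splitEdges⁻ : ∀ {ab} → ab ∈ splitEdges → ∃ λ w → ∃ λ x → x ∈ nbrs w × ab ≡ splitEdge w x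
  ∈-splitEdges⁻ ab∈ with Any.satisfied (∈-concatMap⁻ splitEdgesAt {xs = allFin n} ab∈)
  ... | w , ab∈w with ∈-map⁻ (splitEdge w) ab∈w
  ...   | x , x∈ , refl = w , x , x∈ , refl

  splitEdges-sym : ∀ {a b} → (a , b) ∈ splitEdges → (b , a) ∈ splitEdges
  splitEdges-sym ab∈ with ∈-splitEdges⁻ ab∈
  ... | w , x , x∈ , refl = ∈-splitEdges⁺ (nbrs-sym x∈)

  splitEdges-source< : ∀ {a b} → (a , b) ∈ splitEdges → a < N
  splitEdges-source< ab∈ = ∈-upTo⁻ (∈-resp-↭ S-partition (subst (_ ∈_) sources-splitEdges (∈-map⁺ proj₁ ab∈)))

  splitEdges-sources-count : ∀ x → x < N → length (filter (λ ed → proj₁ ed ≟ x) splitEdges) ≡ 1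
  splitEdges-sources-count x x<N = begin
    length (filter (λ ed → proj₁ ed ≟ x) splitEdges)  ≡⟨ length-filter-map (_≟ x) proj₁ splitEdges ⟩
    length (filter (_≟ x) (map proj₁ splitEdges))     ≡⟨ cong (length ∘ filter (_≟ x)) sources-splitEdges ⟩
    length (filter (_≟ x) (concatMap S (allFin n)))   ≡⟨ ↭-length (filter-↭ (_≟ x) S-partition) ⟩
    length (filter (_≟ x) (upTo N))
      ≡⟨ length-filter-unique (_≟ x) (upTo⁺ N) (∈-upTo⁺ x<N) refl (λ _ _ y≡x → y≡x) ⟩
    1                                                 ∎
    where open ≡-Reasoning

  splitEdges-between-count : ∀ u v → T (adj u v) →
    length (filter (λ ed → (proj₁ ed ∈? S u) ×-dec (proj₂ ed ∈? S v)) splitEdges) ≡ 1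
  splitEdges-between-count u v uv =
    length-filter-unique _ splitEdges-unique (∈-splitEdges⁺ v∈)
                         (split-rank∈S v∈ , split-rank∈S (nbrs-sym v∈)) onlyEdge
    where
    v∈ : v ∈ nbrs u
    v∈ = ∈-nbrs⁺ uv
    sameBlock : ∀ {w u a} → a ∈ S w → a ∈ S u → w ≡ u
    sameBlock = Unique-concatMap⇒disjoint S-unique (∈-allFin _) (∈-allFin _)
    onlyEdge : ∀ ed → ed ∈ splitEdges → proj₁ ed ∈ S u × proj₂ ed ∈ S v → ed ≡ splitEdge u v
    onlyEdge ed ed∈ (a∈Su , b∈Sv) with ∈-splitEdges⁻ ed∈
    ... | w , x , x∈ , refl =
      cong₂ splitEdge (sameBlock (split-rank∈S x∈) a∈Su) (sameBlock (split-rank∈S (nbrs-sym x∈)) b∈Sv)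

  -- The counters of step (2)

  counters : (Fin n → ℕ) → List (ℕ × Fin n) → (Fin n → ℕ)
  counters E []             = E
  counters E ((_ , x) ∷ ws) = counters (increment E x) ws

  run-++ : ∀ E xs ys → run E (xs ++ ys) ≡ run E xs ++ run (counters E xs) ys
  run-++ E []             ys = refl
  run-++ E ((s , x) ∷ xs) ys = cong ((s , E x) ∷_) (run-++ (increment E x) xs ys)

  increment-other : ∀ E {x y} → ¬ T (y == x) → increment E x y ≡ E y
  increment-other E {x} {y} y≠x with y == x
  ... | false = refl
  ... | true  = ⊥-elim (y≠x _)

  increment-self : ∀ E {x y} → T (y == x) → increment E x y ≡ suc (E y)
  increment-self E {x} {y} y=x with y == x in y==x
  ... | true  = cong (suc ∘ E) (sym (==⇒≡ (Equivalence.from T-≡ y==x)))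
  ... | false = ⊥-elim y=x

  run-distinct : ∀ (t : Fin n → ℕ) E L → Sorted L → run E (map (λ x → (t x , x)) L) ≡ map (λ x → (t x , E x)) L
  run-distinct t E []       _                  = refl
  run-distinct t E (y ∷ ys) (y<ys ∷ sorted) =
    cong ((t y , E y) ∷_) (trans (run-distinct t (increment E y) ys sorted)
      (map-cong-local (All.map (λ {x} y<x → cong (t x ,_) (increment-other E (≢⇒¬== (>⇒≢ y<x)))) y<ys)))

  counters-map : ∀ (t : Fin n → ℕ) E L y → counters E (map (λ x → (t x , x)) L) y ≡ E y + length (filterᵇ (y ==_) L)
  counters-map t E []      y = sym (+-identityʳ (E y))
  counters-map t E (x ∷ L) y with T? (y == x)
  ... | yes y=x = begin
    counters (increment E x) (map (λ x → (t x , x)) L) y  ≡⟨ counters-map t (increment E x) L y ⟩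
    increment E x y + length (filterᵇ (y ==_) L)          ≡⟨ cong (_+ _) (increment-self E y=x) ⟩
    suc (E y) + length (filterᵇ (y ==_) L)                ≡⟨ +-suc (E y) _ ⟨
    E y + length (x ∷ filterᵇ (y ==_) L)                  ≡⟨ cong (λ l → E y + length l) (filter-accept (T? ∘ (y ==_)) y=x) ⟨
    E y + length (filterᵇ (y ==_) (x ∷ L))                ∎
    where open ≡-Reasoning
  ... | no y≠x = trans (counters-map t (increment E x) L y)
                       (cong₂ _+_ (increment-other E y≠x) (cong length (sym (filter-reject (T? ∘ (y ==_)) y≠x))))

  count-nbrs : ∀ w x → length (filterᵇ (x ==_) (nbrs w)) ≡ (if adj w x then 1 else 0)
  count-nbrs w x with adj w x in wx
  ... | true  = cong length (filter-==-sorted (nbrs-sorted w) (∈-nbrs⁺ (Equivalence.from T-≡ wx)))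
  ... | false = cong length (filter-none (T? ∘ (x ==_)) (All.tabulate λ z∈ x=z →
                  subst T wx (subst (T ∘ adj w) (sym (==⇒≡ x=z)) (∈-nbrs⁻ z∈))))

  isNbrBefore : Fin n → Fin n → Fin n → Bool
  isNbrBefore x w w′ = adj x w′ ∧ (w′ ≺ w)

  nbrsBefore : Fin n → Fin n → List (Fin n) → List (Fin n)
  nbrsBefore x w = filterᵇ (isNbrBefore x w)

  -- The loop invariant of step (2) on one PE, Ws being the owned nodes still to be traversed.
  Synchronised : (Fin n → ℕ) → List (Fin n) → Set
  Synchronised E Ws = ∀ {w x} → w ∈ Ws → T (adj w x) → E x + length (nbrsBefore x w Ws) ≡ split x (rank x w)

  -- work q unfolds to concatMap workAt (owned q).
  workAt : Fin n → List (ℕ × Fin n)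
  workAt w = map (λ ix → (split w (proj₁ ix) , proj₂ ix)) (enumFrom 1 (nbrs w))

  workAt-ranked : ∀ w → workAt w ≡ map (λ x → (split w (rank w x) , x)) (nbrs w)
  workAt-ranked w = trans (cong (map _) (enumFrom-position (nbrs w) 1 (nbrs-sorted w))) (sym (map-∘ (nbrs w)))

  counters-workAt : ∀ E w x → counters E (workAt w) x ≡ E x + (if adj w x then 1 else 0)
  counters-workAt E w x = begin
    counters E (workAt w) x                                          ≡⟨ cong (λ ws → counters E ws x) (workAt-ranked w) ⟩
    counters E (map (λ x → (split w (rank w x) , x)) (nbrs w)) x     ≡⟨ counters-map _ E (nbrs w) x ⟩
    E x + length (filterᵇ (x ==_) (nbrs w))                          ≡⟨ cong (E x +_) (count-nbrs w x) ⟩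
    E x + (if adj w x then 1 else 0)                                 ∎
    where open ≡-Reasoning

  nbrsBefore-cons : ∀ x {w₀ w} rest → toℕ w₀ < toℕ w →
                    length (nbrsBefore x w (w₀ ∷ rest)) ≡ (if adj w₀ x then 1 else 0) + length (nbrsBefore x w rest)
  nbrsBefore-cons x {w₀} {w} rest w₀<w with adj w₀ x in w₀x
  ... | true  = cong length (filter-accept (T? ∘ isNbrBefore x w)
                  (Equivalence.from T-∧ (Equivalence.from T-≡ (trans (adj-sym x w₀) w₀x) , <⇒≺ w₀<w)))
  ... | false = cong length (filter-reject (T? ∘ isNbrBefore x w)
                  (λ x~w₀ → subst T (trans (adj-sym x w₀) w₀x) (proj₁ (Equivalence.to T-∧ x~w₀))))

  synchronised-head : ∀ {E w₀ rest} → All (λ c → toℕ w₀ < toℕ c) rest → Synchronised E (w₀ ∷ rest) →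
                      ∀ {x} → x ∈ nbrs w₀ → E x ≡ split x (rank x w₀)
  synchronised-head {E} {w₀} {rest} w₀<rest sync {x} x∈ = begin
    E x                                          ≡⟨ +-identityʳ (E x) ⟨
    E x + 0                                      ≡⟨ cong (λ l → E x + length l) nothingBefore ⟨
    E x + length (nbrsBefore x w₀ (w₀ ∷ rest))   ≡⟨ sync (here refl) (∈-nbrs⁻ x∈) ⟩
    split x (rank x w₀)                          ∎
    where
    open ≡-Reasoning
    nothingBefore : nbrsBefore x w₀ (w₀ ∷ rest) ≡ []
    nothingBefore = filter-none (T? ∘ isNbrBefore x w₀)
      (All.map (λ {c} w₀≤c x~c → ≤⇒⊀ {a = c} w₀≤c (proj₂ (Equivalence.to T-∧ x~c))) (≤-refl ∷ All.map <⇒≤ w₀<rest))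

  synchronised-step : ∀ {E w₀ rest} → All (λ c → toℕ w₀ < toℕ c) rest → Synchronised E (w₀ ∷ rest) →
                      Synchronised (counters E (workAt w₀)) rest
  synchronised-step {E} {w₀} {rest} w₀<rest sync {w} {x} w∈ wx = begin
    counters E (workAt w₀) x + length (nbrsBefore x w rest)        ≡⟨ cong (_+ _) (counters-workAt E w₀ x) ⟩
    E x + (if adj w₀ x then 1 else 0) + length (nbrsBefore x w rest) ≡⟨ +-assoc (E x) _ _ ⟩
    E x + ((if adj w₀ x then 1 else 0) + length (nbrsBefore x w rest))
                                         ≡⟨ cong (E x +_) (nbrsBefore-cons x rest (All.lookup w₀<rest w∈)) ⟨
    E x + length (nbrsBefore x w (w₀ ∷ rest))                      ≡⟨ sync (there w∈) wx ⟩
    split x (rank x w)                                              ∎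
    where open ≡-Reasoning

  run-synchronised : ∀ {E} Ws → Sorted Ws → Synchronised E Ws →
                     run E (concatMap workAt Ws) ≡ concatMap splitEdgesAt Ws
  run-synchronised []           _                  _    = refl
  run-synchronised {E} (w₀ ∷ rest) (w₀<rest ∷ sorted) sync = begin
    run E (workAt w₀ ++ concatMap workAt rest)                                      ≡⟨ run-++ E (workAt w₀) _ ⟩
    run E (workAt w₀) ++ run (counters E (workAt w₀)) (concatMap workAt rest)
                   ≡⟨ cong₂ _++_ firstNode (run-synchronised rest sorted (synchronised-step w₀<rest sync)) ⟩
    splitEdgesAt w₀ ++ concatMap splitEdgesAt rest                                   ∎
    where
    open ≡-Reasoning
    firstNode : run E (workAt w₀) ≡ splitEdgesAt w₀
    firstNode = begin
      run E (workAt w₀)                                         ≡⟨ cong (run E) (workAt-ranked w₀) ⟩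
      run E (map (λ x → (split w₀ (rank w₀ x) , x)) (nbrs w₀))  ≡⟨ run-distinct _ E (nbrs w₀) (nbrs-sorted w₀) ⟩
      map (λ x → (split w₀ (rank w₀ x) , E x)) (nbrs w₀)
        ≡⟨ map-cong-local (All.tabulate λ x∈ → cong (_ ,_) (synchronised-head w₀<rest sync x∈)) ⟩
      splitEdgesAt w₀                                           ∎

  module _ (contiguous : ContiguousOwner own) where

    own-between : ∀ {c u w} → toℕ c ≤ toℕ u → toℕ u ≤ toℕ w → own c ≡ own w → own u ≡ own w
    own-between {c} {u} {w} c≤u u≤w c~w =
      toℕ-injective (≤-antisym (contiguous u w u≤w)
                               (subst (λ q → toℕ q ≤ toℕ (own u)) c~w (contiguous c u c≤u)))

    sameOwnerBefore : Fin n → Fin n → Bool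
    sameOwnerBefore w u = own u == own w ∧ (u ≺ w)

    firstPos-owned : ∀ {w} L → Sorted L → w ∈ L →
                     ∃ λ a → firstPos (λ v → own v == own w) L ≡ just (suc a)
                           × a + length (filterᵇ (sameOwnerBefore w) L) ≡ length (before w L)
    firstPos-owned {w} (c ∷ cs) (c<cs ∷ sorted) w∈ with T? (own c == own w)
    ... | yes c~w = 0 , firstPos-here (λ v → own v == own w) {xs = cs} c~w
                      , cong length (filterᵇ-cong-local
                                       (ownedOnward c ≤-refl ∷ All.map (λ {u} → ownedOnward u ∘ <⇒≤) c<cs))
      where
      ownedOnward : ∀ u → toℕ c ≤ toℕ u → sameOwnerBefore w u ≡ (u ≺ w)
      ownedOnward u c≤u with u ≺ w in u<w
      ... | false = ∧-zeroʳ _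
      ... | true  = cong (_∧ true) (Equivalence.to T-≡
                      (subst (λ q → T (q == own w)) (sym (own-between c≤u u≤w (==⇒≡ c~w))) (==-refl (own w))))
        where
        u≤w : toℕ u ≤ toℕ w
        u≤w = <⇒≤ (≺⇒< {a = u} (Equivalence.from T-≡ u<w))
    ... | no c≁w with w∈
    ...   | here refl   = ⊥-elim (c≁w (==-refl (own c)))
    ...   | there w∈cs with firstPos-owned cs sorted w∈cs
    ...     | a , first , count = suc a , firstPos-there (λ v → own v == own w) {xs = cs} c≁w first , (begin
      suc a + length (filterᵇ (sameOwnerBefore w) (c ∷ cs))
        ≡⟨ cong (λ l → suc a + length l) (filter-reject (T? ∘ sameOwnerBefore w) (c≁w ∘ proj₁ ∘ Equivalence.to T-∧)) ⟩
      suc (a + length (filterᵇ (sameOwnerBefore w) cs))    ≡⟨ cong suc count ⟩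
      suc (length (before w cs))                           ≡⟨ cong length (before-cons (All.lookup c<cs w∈cs)) ⟨
      length (before w (c ∷ cs))                           ∎)
      where open ≡-Reasoning

    nbrsBefore-owned : ∀ x w → nbrsBefore x w (owned (own w)) ≡ filterᵇ (sameOwnerBefore w) (nbrs x)
    nbrsBefore-owned x w = begin
      filterᵇ (isNbrBefore x w) (filterᵇ (λ u → own u == own w) (allFin n))
        ≡⟨ filterᵇ-filterᵇ (isNbrBefore x w) (λ u → own u == own w) (allFin n) ⟩
      filterᵇ (λ u → (own u == own w) ∧ (adj x u ∧ (u ≺ w))) (allFin n)
        ≡⟨ filterᵇ-cong-local {xs = allFin n} (All.tabulate λ {u} _ → ∧-swap (own u == own w) (adj x u) (u ≺ w)) ⟩
      filterᵇ (λ u → adj x u ∧ sameOwnerBefore w u) (allFin n)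
        ≡⟨ filterᵇ-filterᵇ (sameOwnerBefore w) (adj x) (allFin n) ⟨
      filterᵇ (sameOwnerBefore w) (nbrs x) ∎
      where
      open ≡-Reasoning
      ∧-swap : ∀ a b c → a ∧ (b ∧ c) ≡ b ∧ (a ∧ c)
      ∧-swap a b c = trans (sym (∧-assoc a b c)) (trans (cong (_∧ c) (∧-comm a b)) (∧-assoc b a c))

    initE-synchronised : ∀ q → Synchronised (initE q) (owned q)
    initE-synchronised q {w} {x} w∈ wx with ∈-owned⁻ w∈
    ... | refl with firstPos-owned (nbrs x) (nbrs-sorted x) (nbrs-sym (∈-nbrs⁺ wx))
    ...   | a , first , count = begin
      initE (own w) x + length (nbrsBefore x w (owned (own w)))
        ≡⟨ cong₂ _+_ (cong (maybe (λ j → M (own x) + e x + j ∸ 1) 0) first) (cong length (nbrsBefore-owned x w)) ⟩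
      split x (suc a) + length (filterᵇ (sameOwnerBefore w) (nbrs x))
        ≡⟨ cong (_+ length (filterᵇ (sameOwnerBefore w) (nbrs x))) (split-suc x a) ⟩
      M (own x) + e x + a + length (filterᵇ (sameOwnerBefore w) (nbrs x))
        ≡⟨ +-assoc (M (own x) + e x) a _ ⟩
      M (own x) + e x + (a + length (filterᵇ (sameOwnerBefore w) (nbrs x)))
        ≡⟨ cong (M (own x) + e x +_) count ⟩
      M (own x) + e x + length (before w (nbrs x))
        ≡⟨ split-suc x (length (before w (nbrs x))) ⟨
      split x (rank x w) ∎
      where open ≡-Reasoning

    dominantEdges-↭ : dominantEdges ↭ splitEdges
    dominantEdges-↭ =
      ↭-trans (↭-reflexive (concatMap-cong runOnPE (allFin P))) (concatMap-groupBy-↭ own splitEdgesAt (allFin n))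
      where
      runOnPE : ∀ q → run (initE q) (work q) ≡ concatMap splitEdgesAt (owned q)
      runOnPE q = run-synchronised (owned q) (owned-sorted q) (initE-synchronised q)

lemma1 : ∀ {n P : ℕ} (G : SimpleGraph n) (own : Fin n → Fin P)
           → ContiguousOwner own
           → let open dSPAC G own in
             -- the split node sets S_u partition the node set {0,…,N-1}
             (concatMap S (allFin n) ↭ upTo N)
             -- auxiliary edges connect each S_u into a cycle (single edge if |S_u| = 2)
           × (auxiliaryEdges ≡ concatMap (λ u → cycleEdges (S u)) (allFin n))
             -- dominant edges lie in the node set and are symmetric
           × (∀ x y → (x , y) ∈ dominantEdges → x < N × y < N)
           × (∀ x y → (x , y) ∈ dominantEdges → (y , x) ∈ dominantEdges)
             -- each split node is incident to exactly one dominant edge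
           × (∀ x → x < N → outCount x ≡ 1)
             -- each edge {u,v} ∈ E is joined by exactly one dominant edge
           × (∀ u v → SimpleGraph.adj G u v ≡ true → betweenCount u v ≡ 1)
lemma1 {n} G own contiguous =
    S-partition
  , concatMap-cong auxFor≡cycleEdges (allFin n)
  , (λ x y xy∈ → let xy∈′ = ∈-resp-↭ dominant↭split xy∈ in
                 splitEdges-source< xy∈′ , splitEdges-source< (splitEdges-sym xy∈′))
  , (λ x y xy∈ → ∈-resp-↭ (↭-sym dominant↭split) (splitEdges-sym (∈-resp-↭ dominant↭split xy∈)))
  , (λ x x<N → trans (↭-length (filter-↭ _ dominant↭split)) (splitEdges-sources-count x x<N))
  , (λ u v uv → trans (↭-length (filter-↭ _ dominant↭split)) (splitEdges-between-count u v (Equivalence.from T-≡ uv)))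
  where
  open SplitGraphProperties G own
  dominant↭split : dSPAC.dominantEdges G own ↭ splitEdges
  dominant↭split = dominantEdges-↭ contiguous
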